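{- Let $G^\rightarrow$ be an orientation of a simple connected graph on $n\ge 2$ vertices labelled $v_1,\dots,v_n$, with initial populations $\rho(v_i)=i$. For any predator-prey strategy applied to $G^\rightarrow$ via the Grog algorithm, in the final amended graph $G^\rightarrow_*$ there is at least one vertex $v_i$ with $\rho_{G^\rightarrow_*}(v_i)=0$ and at least one vertex $v_j$ with $\rho_{G^\rightarrow_*}(v_j)>0$.
   Context: Grog algorithm: Let $G^\rightarrow$ be an orientation of a simple connected graph on $n\ge2$ vertices, the vertices labelled bijectively $v_1,\dots,v_n$, and give each vertex $v_i$ the initial population $\rho(v_i)=i$. A step consists of choosing a vertex $v_i$ and a number $\ell\ge 1$ of arcs $(v_i,v_j)$ still present in the current graph, with $\ell$ at most the current population of $v_i$, such that each chosen head $v_j$ has current population at least $1$ ($v_i$ "preys" along each chosen arc, one predator per arc); the chosen arcs are removed, the population of $v_i$ decreases by $\ell$, and the population of each chosen head decreases by $1$. Steps are repeated until no further step is possible (exit step); the resulting graph with its populations is the final amended graph $G^\rightarrow_*$, and $\rho_{G^\rightarrow_*}(v)$ is the final population of $v$. A predator-prey strategy is any such sequence of steps carried out until termination. -}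

module Defs where

open import Data.Nat using (ℕ; zero; suc; _≤_; _<_; _∸_)
open import Data.Fin using (Fin; toℕ; _≟_)
open import Data.Bool using (Bool; true; false; _∧_; not; if_then_else_)
open import Data.List using (List; length)
open import Data.List.Relation.Unary.All using (All)
open import Data.List.Relation.Unary.Any using (any?)
open import Data.List.Relation.Unary.Unique.Propositional using (Unique)
open import Data.Product using (Σ; _×_)
open import Data.Sum using (_⊎_)
open import Relation.Nullary using (¬_)
open import Relation.Nullary.Decidable using (⌊_⌋)
open import Relation.Binary.PropositionalEquality using (_≡_)
open import Relation.Binary.Construct.Closure.ReflexiveTransitive using (Star)

-- A directed graph on the vertex set Fin n, given by its arc indicator:
-- arc u v ≡ true  iff  (u , v) is an arc.
Digraph : ℕ → Set
Digraph n = Fin n → Fin n → Bool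

IsOrientation : ∀ {n} → Digraph n → Set
IsOrientation {n} A =
  ((u : Fin n) → A u u ≡ false) ×
  ((u v : Fin n) → A u v ≡ true → A v u ≡ false)

Adj : ∀ {n} → Digraph n → Fin n → Fin n → Set
Adj A u v = (A u v ≡ true) ⊎ (A v u ≡ true)

Connected : ∀ {n} → Digraph n → Set
Connected {n} A = (u v : Fin n) → Star (Adj A) u v

record State (n : ℕ) : Set where
  constructor mkState
  field
    arcs : Digraph n
    pop  : Fin n → ℕ
open State public

-- initial state: vertex v_i (index i-1 in Fin n) has population i
initial : ∀ {n} → Digraph n → State n
initial A = mkState A (λ u → suc (toℕ u))

_∈ᵇ_ : ∀ {n} → Fin n → List (Fin n) → Bool
v ∈ᵇ js = ⌊ any? (v ≟_) js ⌋

-- One step of the Grog algorithm: vertex `pred` preys along the arcs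
-- (pred , j) for the distinct heads j in `heads` (ℓ = length heads ≥ 1,
-- ℓ ≤ population of pred, each head has population ≥ 1); those arcs are
-- removed, pred loses ℓ and each head loses 1.
record Step {n : ℕ} (s s' : State n) : Set where
  field
    pred     : Fin n
    heads    : List (Fin n)
    distinct : Unique heads
    nonempty : 1 ≤ length heads
    bound    : length heads ≤ pop s pred
    arcsIn   : All (λ j → arcs s pred j ≡ true) heads
    headsPop : All (λ j → 1 ≤ pop s j) heads
    newArcs  : (u v : Fin n) →
               arcs s' u v ≡ (arcs s u v ∧ not (⌊ u ≟ pred ⌋ ∧ (v ∈ᵇ heads)))
    newPop   : (u : Fin n) →
               pop s' u ≡ (pop s u ∸ (if ⌊ u ≟ pred ⌋ then length heads else 0))
                            ∸ (if u ∈ᵇ heads then 1 else 0)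

Terminal : ∀ {n} → State n → Set
Terminal {n} s = (s' : State n) → ¬ Step s s'

FinalAmended : ∀ {n} → Digraph n → State n → Set
FinalAmended A s = Star Step (initial A) s × Terminal s

-- A step removes from each vertex at least as many incident arcs as it takes from
-- its population, so  degree < population  is invariant.  It holds initially for
-- v_n, whose population n exceeds its degree (at most n − 1, as the graph is simple),
-- so v_n survives.  The vertex v_1 starts with population 1: it dies in the first
-- step it takes part in, and until then its arc to a fixed neighbour w survives.
-- In a terminal state either v_1 or w is therefore extinct, since otherwise one of
-- them could still prey on the other along that arc.

module Submission where

open import Defs
open import Data.Nat using (ℕ; zero; suc; _≤_; _<_; _+_; _∸_; z≤n; s≤s)
open import Data.Nat.Properties
  using (module ≤-Reasoning; +-comm; +-identityʳ; +-0-commutativeMonoid; +-commutativeSemigroup; ≤-trans; ≤-reflexive; ≤-<-trans;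
         +-mono-≤; +-mono-<-≤; +-mono-≤-<; m≤m+n; m≤n+m; ∸-+-assoc; m≤n⇒m∸n≡0; m+n≤o⇒m≤o∸n)
open import Algebra.Properties.CommutativeMonoid.Sum +-0-commutativeMonoid
  using (sum; sum-syntax; ∑-distrib-+; sum-cong-≗; sum-remove; sum-replicate-zero)
open import Algebra.Properties.CommutativeSemigroup +-commutativeSemigroup using (interchange)
open import Data.Fin using (Fin; _≟_; fromℕ; punchIn) renaming (zero to fzero; suc to fsuc)
open import Data.Fin.Properties using (toℕ-fromℕ; punchInᵢ≢i)
open import Data.Bool using (Bool; true; false; _∧_; not; if_then_else_)
open import Data.Bool.Properties using (∧-identityʳ; ∧-zeroʳ)
open import Data.List using (List; []; _∷_; length)
open import Data.List.Relation.Unary.All as All using (All; []; _∷_)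
open import Data.List.Relation.Unary.All.Properties using (All¬⇒¬Any)
open import Data.List.Relation.Unary.Any using (any?)
open import Data.List.Relation.Unary.AllPairs using ([]; _∷_)
open import Data.List.Relation.Unary.Unique.Propositional using (Unique)
open import Data.Product using (Σ; ∃; _×_; _,_; proj₁; proj₂; uncurry)
open import Data.Sum using (_⊎_; inj₁; inj₂) renaming (map to ⊎-map)
open import Data.Empty using (⊥-elim)
open import Function using (_∘_; id)
open import Relation.Nullary using (Dec; yes; no)
open import Relation.Nullary.Decidable using (⌊_⌋)
open import Relation.Binary.PropositionalEquality
  using (_≡_; _≢_; refl; sym; trans; cong; cong₂; subst; module ≡-Reasoning; ≡-≟-identity; ≢-≟-identity)
open import Relation.Binary.Construct.Closure.ReflexiveTransitive using (Star; _◅_; fold)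

⟦_⟧ : Bool → ℕ
⟦ true  ⟧ = 1
⟦ false ⟧ = 0

⟦⟧≤1 : ∀ b → ⟦ b ⟧ ≤ 1
⟦⟧≤1 true  = s≤s z≤n
⟦⟧≤1 false = z≤n

⟦∧⟧≤⟦⟧ : ∀ a b → ⟦ a ∧ b ⟧ ≤ ⟦ a ⟧
⟦∧⟧≤⟦⟧ true  true  = s≤s z≤n
⟦∧⟧≤⟦⟧ true  false = z≤n
⟦∧⟧≤⟦⟧ false b     = z≤n

⟦∧not⟧+⟦⟧≡⟦⟧ : ∀ a c → (c ≡ true → a ≡ true) → ⟦ a ∧ not c ⟧ + ⟦ c ⟧ ≡ ⟦ a ⟧
⟦∧not⟧+⟦⟧≡⟦⟧ a     true  c⇒a rewrite c⇒a refl = refl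
⟦∧not⟧+⟦⟧≡⟦⟧ true  false _   = refl
⟦∧not⟧+⟦⟧≡⟦⟧ false false _   = refl

isYes-sound : ∀ {a} {A : Set a} (a? : Dec A) → ⌊ a? ⌋ ≡ true → A
isYes-sound (yes a) _ = a
isYes-sound (no _) ()

⌊≟⌋-refl : ∀ {n} (x : Fin n) → ⌊ x ≟ x ⌋ ≡ true
⌊≟⌋-refl x = cong ⌊_⌋ (≡-≟-identity _≟_ refl)

⌊≟⌋-≢ : ∀ {n} {x y : Fin n} → x ≢ y → ⌊ x ≟ y ⌋ ≡ false
⌊≟⌋-≢ x≢y = cong ⌊_⌋ (≢-≟-identity _≟_ x≢y)

⟦∈ᵇ∷⟧ : ∀ {n} {x : Fin n} {xs} → All (x ≢_) xs →
        ∀ v → ⟦ v ∈ᵇ (x ∷ xs) ⟧ ≡ ⟦ ⌊ v ≟ x ⌋ ⟧ + ⟦ v ∈ᵇ xs ⟧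
⟦∈ᵇ∷⟧ {x = x} {xs} x∉xs v with v ≟ x | any? (v ≟_) xs
... | yes refl | yes x∈xs = ⊥-elim (All¬⇒¬Any x∉xs x∈xs)
... | yes _    | no _     = refl
... | no _     | yes _    = refl
... | no _     | no _     = refl

sum-mono-≤ : ∀ {n} {f g : Fin n → ℕ} → (∀ i → f i ≤ g i) → sum f ≤ sum g
sum-mono-≤ {zero}  _   = z≤n
sum-mono-≤ {suc n} f≤g = +-mono-≤ (f≤g fzero) (sum-mono-≤ (f≤g ∘ fsuc))

sum-mono-< : ∀ {n} {f g : Fin n → ℕ} (i : Fin n) → (∀ j → f j ≤ g j) → f i < g i → sum f < sum g
sum-mono-< fzero    f≤g fi<gi = +-mono-<-≤ fi<gi (sum-mono-≤ (f≤g ∘ fsuc))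
sum-mono-< (fsuc i) f≤g fi<gi = +-mono-≤-< (f≤g fzero) (sum-mono-< i (f≤g ∘ fsuc) fi<gi)

sum-const-1 : ∀ n → ∑[ i < n ] 1 ≡ n
sum-const-1 zero    = refl
sum-const-1 (suc n) = cong suc (sum-const-1 n)

sum-⌊≟⌋ : ∀ {n} (x : Fin n) → ∑[ v < n ] ⟦ ⌊ v ≟ x ⌋ ⟧ ≡ 1
sum-⌊≟⌋ {suc n} x = begin
  ∑[ v < suc n ] ⟦ ⌊ v ≟ x ⌋ ⟧                        ≡⟨ sum-remove {i = x} (λ v → ⟦ ⌊ v ≟ x ⌋ ⟧) ⟩
  ⟦ ⌊ x ≟ x ⌋ ⟧ + ∑[ j < n ] ⟦ ⌊ punchIn x j ≟ x ⌋ ⟧  ≡⟨ cong₂ _+_ (cong ⟦_⟧ (⌊≟⌋-refl x)) others ⟩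
  1                                                   ∎
  where
  open ≡-Reasoning
  others : ∑[ j < n ] ⟦ ⌊ punchIn x j ≟ x ⌋ ⟧ ≡ 0
  others = trans (sum-cong-≗ (cong ⟦_⟧ ∘ ⌊≟⌋-≢ ∘ punchInᵢ≢i x)) (sum-replicate-zero n)

sum-∈ᵇ : ∀ {n} {L : List (Fin n)} → Unique L → ∑[ v < n ] ⟦ v ∈ᵇ L ⟧ ≡ length L
sum-∈ᵇ {n} []                          = sum-replicate-zero n
sum-∈ᵇ {n} {x ∷ xs} (x∉xs ∷ xs-unique) = begin
  ∑[ v < n ] ⟦ v ∈ᵇ (x ∷ xs) ⟧                             ≡⟨ sum-cong-≗ (⟦∈ᵇ∷⟧ x∉xs) ⟩
  ∑[ v < n ] (⟦ ⌊ v ≟ x ⌋ ⟧ + ⟦ v ∈ᵇ xs ⟧)                 ≡⟨ ∑-distrib-+ (λ v → ⟦ ⌊ v ≟ x ⌋ ⟧) (λ v → ⟦ v ∈ᵇ xs ⟧) ⟩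
  ∑[ v < n ] ⟦ ⌊ v ≟ x ⌋ ⟧ + ∑[ v < n ] ⟦ v ∈ᵇ xs ⟧        ≡⟨ cong₂ _+_ (sum-⌊≟⌋ x) (sum-∈ᵇ xs-unique) ⟩
  suc (length xs)                                          ∎
  where open ≡-Reasoning

preserved-along : ∀ {a r p} {I : Set a} {R : I → I → Set r} (P : I → Set p) →
                  (∀ {i j} → R i j → P i → P j) → ∀ {i j} → Star R i j → P i → P j
preserved-along P pres = fold (λ i j → P i → P j) (λ r k → k ∘ pres r) id

module _ {n : ℕ} where

  outDegree inDegree degree : Digraph n → Fin n → ℕ
  outDegree A u = ∑[ v < n ] ⟦ A u v ⟧
  inDegree  A u = ∑[ v < n ] ⟦ A v u ⟧
  degree    A u = outDegree A u + inDegree A u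

  degree-< : {A : Digraph n} → IsOrientation A → ∀ u → degree A u < n
  degree-< {A} (loopless , antisymmetric) u = begin-strict
    outDegree A u + inDegree A u       ≡⟨ ∑-distrib-+ (λ v → ⟦ A u v ⟧) (λ v → ⟦ A v u ⟧) ⟨
    ∑[ v < n ] (⟦ A u v ⟧ + ⟦ A v u ⟧) <⟨ sum-mono-< u at-most-one-arc no-loop ⟩
    ∑[ v < n ] 1                       ≡⟨ sum-const-1 n ⟩
    n                                  ∎
    where
    open ≤-Reasoning
    at-most-one-arc : ∀ v → ⟦ A u v ⟧ + ⟦ A v u ⟧ ≤ 1
    at-most-one-arc v with A u v in uv
    ... | true  rewrite antisymmetric u v uv = s≤s z≤n
    ... | false = ⟦⟧≤1 (A v u)
    no-loop : ⟦ A u u ⟧ + ⟦ A u u ⟧ < 1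
    no-loop rewrite loopless u = s≤s z≤n

module StepProperties {n : ℕ} {s s' : State n} (step : Step s s') where
  open Step step

  predatorLoss preyLoss loss : Fin n → ℕ
  predatorLoss u = if ⌊ u ≟ pred ⌋ then length heads else 0
  preyLoss     u = if u ∈ᵇ heads then 1 else 0
  loss         u = predatorLoss u + preyLoss u

  pop-step : ∀ u → pop s' u ≡ pop s u ∸ loss u
  pop-step u = trans (newPop u) (∸-+-assoc (pop s u) (predatorLoss u) (preyLoss u))

  pop-exhausted : ∀ {u} → pop s u ≤ loss u → pop s' u ≡ 0
  pop-exhausted {u} p≤l = trans (pop-step u) (m≤n⇒m∸n≡0 p≤l)

  pop-untouched : ∀ {u} → u ≢ pred → u ∈ᵇ heads ≡ false → pop s' u ≡ pop s u
  pop-untouched {u} u≢pred u∉heads rewrite pop-step u | ⌊≟⌋-≢ u≢pred | u∉heads = refl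

  predator-loses : ∀ {u} → u ≡ pred → 1 ≤ loss u
  predator-loses {u} refl rewrite ⌊≟⌋-refl u = ≤-trans nonempty (m≤m+n (length heads) (preyLoss u))

  prey-loses : ∀ {u} → u ∈ᵇ heads ≡ true → 1 ≤ loss u
  prey-loses {u} u∈heads rewrite u∈heads = m≤n+m 1 (predatorLoss u)

  arcs-≤ : ∀ u v → ⟦ arcs s' u v ⟧ ≤ ⟦ arcs s u v ⟧
  arcs-≤ u v rewrite newArcs u v = ⟦∧⟧≤⟦⟧ (arcs s u v) _

  arcs-from-pred : ∀ v → arcs s' pred v ≡ arcs s pred v ∧ not (v ∈ᵇ heads)
  arcs-from-pred v rewrite newArcs pred v | ⌊≟⌋-refl pred = refl

  arcs-from-other : ∀ {u} → u ≢ pred → ∀ v → arcs s' u v ≡ arcs s u v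
  arcs-from-other {u} u≢pred v rewrite newArcs u v | ⌊≟⌋-≢ u≢pred = ∧-identityʳ (arcs s u v)

  arcs-to-other : ∀ {v} → v ∈ᵇ heads ≡ false → ∀ u → arcs s' u v ≡ arcs s u v
  arcs-to-other {v} v∉heads u rewrite newArcs u v | v∉heads | ∧-zeroʳ ⌊ u ≟ pred ⌋ = ∧-identityʳ (arcs s u v)

  arc-to-head : ∀ {v} → v ∈ᵇ heads ≡ true → arcs s pred v ≡ true
  arc-to-head {v} v∈heads = All.lookup arcsIn (isYes-sound (any? (v ≟_) heads) v∈heads)

  outDegree-pred : outDegree (arcs s') pred + length heads ≡ outDegree (arcs s) pred
  outDegree-pred = begin
    outDegree (arcs s') pred + length heads
      ≡⟨ cong (outDegree (arcs s') pred +_) (sum-∈ᵇ distinct) ⟨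
    outDegree (arcs s') pred + ∑[ v < n ] ⟦ v ∈ᵇ heads ⟧
      ≡⟨ ∑-distrib-+ (λ v → ⟦ arcs s' pred v ⟧) (λ v → ⟦ v ∈ᵇ heads ⟧) ⟨
    ∑[ v < n ] (⟦ arcs s' pred v ⟧ + ⟦ v ∈ᵇ heads ⟧)
      ≡⟨ sum-cong-≗ preyed-arc ⟩
    outDegree (arcs s) pred
      ∎
    where
    open ≡-Reasoning
    preyed-arc : ∀ v → ⟦ arcs s' pred v ⟧ + ⟦ v ∈ᵇ heads ⟧ ≡ ⟦ arcs s pred v ⟧
    preyed-arc v rewrite arcs-from-pred v = ⟦∧not⟧+⟦⟧≡⟦⟧ (arcs s pred v) (v ∈ᵇ heads) arc-to-head

  inDegree-prey : ∀ {u} → u ∈ᵇ heads ≡ true → inDegree (arcs s') u < inDegree (arcs s) u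
  inDegree-prey {u} u∈heads = sum-mono-< pred (λ v → arcs-≤ v u) preyed-arc
    where
    preyed-arc : ⟦ arcs s' pred u ⟧ < ⟦ arcs s pred u ⟧
    preyed-arc rewrite arcs-from-pred u | u∈heads | arc-to-head u∈heads = s≤s z≤n

  outDegree-step : ∀ u → outDegree (arcs s') u + predatorLoss u ≤ outDegree (arcs s) u
  outDegree-step u with u ≟ pred
  ... | yes refl = ≤-reflexive outDegree-pred
  ... | no _     rewrite +-identityʳ (outDegree (arcs s') u) = sum-mono-≤ (arcs-≤ u)

  inDegree-step : ∀ u → inDegree (arcs s') u + preyLoss u ≤ inDegree (arcs s) u
  inDegree-step u with u ∈ᵇ heads in u∈heads
  ... | true  rewrite +-comm (inDegree (arcs s') u) 1 = inDegree-prey u∈heads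
  ... | false rewrite +-identityʳ (inDegree (arcs s') u) = sum-mono-≤ (λ v → arcs-≤ v u)

  degree-step : ∀ u → degree (arcs s') u + loss u ≤ degree (arcs s) u
  degree-step u = ≤-trans (≤-reflexive (interchange (outDegree (arcs s') u) (inDegree (arcs s') u) _ _))
                          (+-mono-≤ (outDegree-step u) (inDegree-step u))

  degree<pop-step : ∀ u → degree (arcs s) u < pop s u → degree (arcs s') u < pop s' u
  degree<pop-step u deg<pop rewrite pop-step u =
    m+n≤o⇒m≤o∸n (suc (degree (arcs s') u)) (≤-trans (s≤s (degree-step u)) deg<pop)

open StepProperties
  using (pop-exhausted; pop-untouched; predator-loses; prey-loses; arcs-from-other; arcs-to-other; degree<pop-step)

single-prey-step : ∀ {n} (s : State n) {p v : Fin n} → arcs s p v ≡ true → 1 ≤ pop s p → 1 ≤ pop s v → ∃ (Step s)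
single-prey-step s {p} {v} arc p-alive v-alive = _ , record
  { pred     = p
  ; heads    = v ∷ []
  ; distinct = [] ∷ []
  ; nonempty = s≤s z≤n
  ; bound    = p-alive
  ; arcsIn   = arc ∷ []
  ; headsPop = v-alive ∷ []
  ; newArcs  = λ _ _ → refl
  ; newPop   = λ _ → refl
  }

adjacent-alive-step : ∀ {n} (s : State n) {u v : Fin n} →
                      Adj (arcs s) u v → 1 ≤ pop s u → 1 ≤ pop s v → ∃ (Step s)
adjacent-alive-step s (inj₁ u→v) u-alive v-alive = single-prey-step s u→v u-alive v-alive
adjacent-alive-step s (inj₂ v→u) u-alive v-alive = single-prey-step s v→u v-alive u-alive

module _ {n : ℕ} (z w : Fin n) where

  ExtinctOrLinked : State n → Set
  ExtinctOrLinked s = pop s z ≡ 0 ⊎ (pop s z ≡ 1 × Adj (arcs s) z w)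

  extinctOrLinked-step : ∀ {s s'} → Step s s' → ExtinctOrLinked s → ExtinctOrLinked s'
  extinctOrLinked-step step (inj₁ z-extinct) =
    inj₁ (pop-exhausted step (≤-trans (≤-reflexive z-extinct) z≤n))
  extinctOrLinked-step step (inj₂ (pop≡1 , linked)) with z ≟ Step.pred step | z ∈ᵇ Step.heads step in z∈heads
  ... | yes z≡pred | _     = inj₁ (pop-exhausted step (≤-trans (≤-reflexive pop≡1) (predator-loses step z≡pred)))
  ... | no _       | true  = inj₁ (pop-exhausted step (≤-trans (≤-reflexive pop≡1) (prey-loses step z∈heads)))
  ... | no z≢pred  | false =
    inj₂ (trans (pop-untouched step z≢pred z∈heads) pop≡1 ,
          ⊎-map (trans (arcs-from-other step z≢pred w)) (trans (arcs-to-other step z∈heads w)) linked)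

  extinct-at-termination : ∀ {s} → Terminal s → ExtinctOrLinked s → ∃ λ i → pop s i ≡ 0
  extinct-at-termination _ (inj₁ z-extinct) = z , z-extinct
  extinct-at-termination {s} terminal (inj₂ (pop≡1 , linked)) with pop s w in w-pop
  ... | zero  = w , w-pop
  ... | suc _ = ⊥-elim (uncurry terminal
                  (adjacent-alive-step s linked (≤-reflexive (sym pop≡1)) (subst (1 ≤_) (sym w-pop) (s≤s z≤n))))

lemma2p1 : (n : ℕ) → 2 ≤ n → (A : Digraph n) → IsOrientation A → Connected A →
           (s : State n) → FinalAmended A s →
           Σ (Fin n) (λ i → pop s i ≡ 0) × Σ (Fin n) (λ j → 0 < pop s j)
lemma2p1 (suc (suc m)) (s≤s (s≤s z≤n)) A orientation connected s (strategy , terminal) =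
  extinct , survivor
  where
  first last : Fin (suc (suc m))
  first = fzero
  last  = fromℕ (suc m)

  neighbour : ∃ (Adj A first)
  neighbour with connected first (fsuc fzero)
  ... | adj ◅ _ = _ , adj

  extinct : ∃ λ i → pop s i ≡ 0
  extinct = extinct-at-termination first w terminal
    (preserved-along (ExtinctOrLinked first w) (extinctOrLinked-step first w) strategy (inj₂ (refl , proj₂ neighbour)))
    where w = proj₁ neighbour

  degree<pop-initially : degree A last < pop (initial A) last
  degree<pop-initially rewrite toℕ-fromℕ (suc m) = degree-< orientation last

  survivor : ∃ λ j → 0 < pop s j
  survivor = last , ≤-<-trans z≤n
    (preserved-along (λ t → degree (arcs t) last < pop t last) (λ step → degree<pop-step step last)
                     strategy degree<pop-initially)
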